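{- Let $X$ be a connected simple graph containing a $k$-bridge, and let $\mathsf{Star}_m$ ($m>2$) be the star on $m$ vertices together with a multiplicity list $c\in\mathbb{Z}_{>0}^m$ in which the center has multiplicity $k\geq 2$ and whose total multiplicity equals $|V(X)|$. Then $\mathsf{FS}_m(X,\mathsf{Star}_m)$ is not connected.
   Context: For a simple graph $X$ on $n$ vertices and a graph $Y$ with multiplicities $c_y\in\mathbb{Z}_{>0}$ summing to $n$, $\mathsf{FS}_m(X,Y)$ has as vertices the functions $\sigma:V(X)\to V(Y)$ with $|\sigma^{ -1}(y)|=c_y$ for all $y$, with $\sigma,\tau$ adjacent if $\sigma=\tau\circ(a\ b)$ for some $ab\in E(X)$ with $\sigma(a)\sigma(b)\in E(Y)$. A $k$-bridge in $X$ is a $k$-tuple of distinct vertices $a_1,\dots,a_k$ with $a_ia_{i+1}\in E(X)$ for $1\le i\le k-1$, such that for each $i\in\{2,\dots,k-1\}$ the only neighbors of $a_i$ are $a_{i-1}$ and $a_{i+1}$, and such that in the graph obtained from $X$ by deleting the edges $a_1a_2,\dots,a_{k-1}a_k$ and the vertices $a_2,\dots,a_{k-1}$, the vertices $a_1$ and $a_k$ lie in different connected components, each of size at least $2$. -}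

module Defs where

open import Data.Nat using (ℕ; zero; suc; _<_)
open import Data.Fin using (Fin; toℕ; _≟_)
open import Data.List using (List; length; filter; map; allFin)
open import Data.Nat.ListAction using (sum)
open import Data.Product using (Σ; ∃; _×_; _,_; proj₁)
open import Data.Sum using (_⊎_)
open import Data.Empty using (⊥)
open import Relation.Nullary using (¬_; yes; no)
open import Relation.Binary.PropositionalEquality using (_≡_; _≢_)
open import Relation.Binary.Construct.Closure.ReflexiveTransitive using (Star)

record SimpleGraph (n : ℕ) : Set₁ where
  field
    E      : Fin n → Fin n → Set
    sym    : ∀ {u v} → E u v → E v u
    irrefl : ∀ {u} → ¬ E u u
open SimpleGraph public

Connected : ∀ {n} → SimpleGraph n → Set
Connected X = ∀ u v → Star (E X) u v

-- k-bridge a_1,…,a_k, indexed as a : Fin k → Fin n (a_1 = a at index 0).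
record KBridge {n : ℕ} (X : SimpleGraph n) (k : ℕ) : Set where
  field
    a        : Fin k → Fin n
    distinct : ∀ i j → a i ≡ a j → i ≡ j
    path     : ∀ (i j : Fin k) → toℕ j ≡ suc (toℕ i) → E X (a i) (a j)
    onlyNbrs : ∀ (i : Fin k) → 0 < toℕ i → suc (toℕ i) < k →
               ∀ w → E X (a i) w →
               ∃ λ (j : Fin k) → (toℕ j ≡ suc (toℕ i) ⊎ suc (toℕ j) ≡ toℕ i) × a j ≡ w
  Internal : Fin n → Set
  Internal v = ∃ λ (i : Fin k) → 0 < toℕ i × suc (toℕ i) < k × a i ≡ v
  PathEdge : Fin n → Fin n → Set
  PathEdge u v = ∃ λ (i : Fin k) → ∃ λ (j : Fin k) → toℕ j ≡ suc (toℕ i) ×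
                   ((a i ≡ u × a j ≡ v) ⊎ (a i ≡ v × a j ≡ u))
  -- adjacency of the graph with those edges and vertices deleted
  E' : Fin n → Fin n → Set
  E' u v = E X u v × ¬ Internal u × ¬ Internal v × ¬ PathEdge u v
  field
    separated : ∀ (i j : Fin k) → toℕ i ≡ 0 → suc (toℕ j) ≡ k →
                ¬ Star E' (a i) (a j)
                × (∃ λ w → w ≢ a i × Star E' (a i) w)
                × (∃ λ w → w ≢ a j × Star E' (a j) w)

HasKBridge : ∀ {n} → SimpleGraph n → ℕ → Set
HasKBridge X k = KBridge X k

StarAdj : ∀ {m} → Fin m → Fin m → Fin m → Set
StarAdj ctr y y' = (y ≡ ctr × y' ≢ ctr) ⊎ (y' ≡ ctr × y ≢ ctr)

fiberSize : ∀ {n m} → (Fin n → Fin m) → Fin m → ℕ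
fiberSize {n} σ y = length (filter (λ i → σ i ≟ y) (allFin n))

totalMult : ∀ {m} → (Fin m → ℕ) → ℕ
totalMult {m} c = sum (map c (allFin m))

swap : ∀ {n} → Fin n → Fin n → Fin n → Fin n
swap a b i with i ≟ a
... | yes _ = b
... | no _ with i ≟ b
...   | yes _ = a
...   | no _ = i

FSVertex : (n m : ℕ) → (Fin m → ℕ) → Set
FSVertex n m c = Σ (Fin n → Fin m) λ σ → ∀ y → fiberSize σ y ≡ c y

FSAdj : ∀ {n m} (X : SimpleGraph n) (EY : Fin m → Fin m → Set) (c : Fin m → ℕ) →
        FSVertex n m c → FSVertex n m c → Set
FSAdj X EY c (σ , _) (τ , _) =
  ∃ λ a → ∃ λ b → E X a b × EY (σ a) (σ b) × (∀ i → σ i ≡ τ (swap a b i))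

FSConnected : ∀ {n m} (X : SimpleGraph n) (EY : Fin m → Fin m → Set) (c : Fin m → ℕ) → Set
FSConnected {n} {m} X EY c = ∀ (s t : FSVertex n m c) → Star (FSAdj X EY c) s t

module Submission where

-- Write a₀ … a_{k-1} for the bridge and A for the component of a₀ once it is deleted.  Leaf
-- tokens move only by trading places with centre tokens, so a leaf can travel along the bridge
-- only as far as the centre tokens behind it allow.  Call a leaf token at v A-sided if
-- v ∈ A ∖ {a₀}, or v = a_t and more than t centre tokens lie in (A ∖ {a₀}) ∪ {a₀, …, a_{t-1}}.
-- Every move maps A-sided leaf tokens to A-sided ones and back: a token would leave A-sided at
-- a_{k-1} only onto a centre token outside A and the bridge, while all k centre tokens are
-- needed behind it.  Two leaf colours y, z satisfy c y + c z ≤ n - k ≤ |A ∖ {a₀}| + |O|, where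
-- O = V ∖ (A ∪ bridge) contains the far component, so one colour fits entirely into O (where no
-- token is A-sided) or into A ∖ {a₀} (where all are); such a configuration is not reachable from
-- one with a token of that colour on the other side.

open import Defs renaming (sym to E-sym)
open import Algebra.Properties.CommutativeSemigroup using (x∙yz≈y∙xz)
open import Data.Empty using (⊥; ⊥-elim)
open import Data.Fin using (Fin; zero; suc; toℕ; fromℕ; _≟_)
import Data.Fin.Properties as Fin
open import Data.List using (length; filter; tabulate)
open import Data.List.Properties using (map-tabulate)
open import Data.Nat as ℕ using (ℕ; zero; suc; _+_; _<_; _≤_; z≤n; s≤s)
open import Data.Nat.ListAction using (sum)
open import Data.Nat.Properties hiding (_≟_)
open import Data.Product using (Σ; ∃; _×_; _,_; proj₁; proj₂)
open import Data.Sum as Sum using (_⊎_; inj₁; inj₂; [_,_])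
open import Function using (_∘_; _⇔_; mk⇔; Equivalence)
open import Level using (0ℓ)
open import Relation.Binary.Construct.Closure.ReflexiveTransitive using (Star; ε; _◅_; _◅◅_; fold; reverse)
open import Relation.Binary.PropositionalEquality
  using (_≡_; _≢_; refl; sym; trans; cong; cong₂; subst; subst₂; module ≡-Reasoning)
open import Relation.Nullary using (¬_; Dec; yes; no; ¬?; _×-dec_; _⊎-dec_; ¬¬-excluded-middle)
open import Relation.Unary using (Pred; Decidable)

private variable
  A B : Set

indicator : Dec A → ℕ
indicator (yes _) = 1
indicator (no _) = 0

indicator-yes : (A? : Dec A) → A → indicator A? ≡ 1
indicator-yes (yes _) _ = refl
indicator-yes (no ¬a) a = ⊥-elim (¬a a)

indicator-no : (A? : Dec A) → ¬ A → indicator A? ≡ 0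
indicator-no (yes a) ¬a = ⊥-elim (¬a a)
indicator-no (no _) _ = refl

indicator-cong : (A? : Dec A) (B? : Dec B) → (A → B) → (B → A) → indicator A? ≡ indicator B?
indicator-cong (yes _) (yes _) _ _ = refl
indicator-cong (yes a) (no ¬b) f _ = ⊥-elim (¬b (f a))
indicator-cong (no ¬a) (yes b) _ g = ⊥-elim (¬a (g b))
indicator-cong (no _) (no _) _ _ = refl

count : ∀ {n} {P : Pred (Fin n) 0ℓ} → Decidable P → ℕ
count {zero} P? = 0
count {suc n} P? = indicator (P? zero) + count (P? ∘ suc)

count-mono : ∀ {n} {P Q : Pred (Fin n) 0ℓ} (P? : Decidable P) (Q? : Decidable Q) →
             (∀ i → P i → Q i) → count P? ≤ count Q?
count-mono {zero} P? Q? P⊆Q = z≤n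
count-mono {suc n} P? Q? P⊆Q with P? zero | Q? zero | count-mono (P? ∘ suc) (Q? ∘ suc) (P⊆Q ∘ suc)
... | yes _ | yes _ | rest = s≤s rest
... | yes p | no ¬q | _ = ⊥-elim (¬q (P⊆Q zero p))
... | no _ | yes _ | rest = m≤n⇒m≤1+n rest
... | no _ | no _ | rest = rest

count-cong : ∀ {n} {P Q : Pred (Fin n) 0ℓ} (P? : Decidable P) (Q? : Decidable Q) →
             (∀ i → P i → Q i) → (∀ i → Q i → P i) → count P? ≡ count Q?
count-cong P? Q? P⊆Q Q⊆P = ≤-antisym (count-mono P? Q? P⊆Q) (count-mono Q? P? Q⊆P)

count-mono-< : ∀ {n} {P Q : Pred (Fin n) 0ℓ} (P? : Decidable P) (Q? : Decidable Q) →
               (∀ i → P i → Q i) → ∀ w → Q w → ¬ P w → count P? < count Q?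
count-mono-< {suc n} P? Q? P⊆Q zero qw ¬pw with P? zero | Q? zero
... | yes pw | _ = ⊥-elim (¬pw pw)
... | no _ | yes _ = s≤s (count-mono (P? ∘ suc) (Q? ∘ suc) (P⊆Q ∘ suc))
... | no _ | no ¬qw = ⊥-elim (¬qw qw)
count-mono-< {suc n} P? Q? P⊆Q (suc w) qw ¬pw
  with P? zero | Q? zero | count-mono-< (P? ∘ suc) (Q? ∘ suc) (P⊆Q ∘ suc) w qw ¬pw
... | yes _ | yes _ | rest = s≤s rest
... | yes p | no ¬q | _ = ⊥-elim (¬q (P⊆Q zero p))
... | no _ | yes _ | rest = m≤n⇒m≤1+n rest
... | no _ | no _ | rest = rest

count-≤ : ∀ {n} {P : Pred (Fin n) 0ℓ} (P? : Decidable P) → count P? ≤ n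
count-≤ {zero} P? = z≤n
count-≤ {suc n} P? with P? zero
... | yes _ = s≤s (count-≤ (P? ∘ suc))
... | no _ = m≤n⇒m≤1+n (count-≤ (P? ∘ suc))

count-full : ∀ {n} {P : Pred (Fin n) 0ℓ} (P? : Decidable P) → (∀ i → P i) → count P? ≡ n
count-full {zero} P? all = refl
count-full {suc n} P? all with P? zero
... | yes _ = cong suc (count-full (P? ∘ suc) (all ∘ suc))
... | no ¬p = ⊥-elim (¬p (all zero))

count-empty : ∀ {n} {P : Pred (Fin n) 0ℓ} (P? : Decidable P) → (∀ i → ¬ P i) → count P? ≡ 0
count-empty {zero} P? none = refl
count-empty {suc n} P? none
  rewrite indicator-no (P? zero) (none zero) = count-empty (P? ∘ suc) (none ∘ suc)

count-pos : ∀ {n} {P : Pred (Fin n) 0ℓ} (P? : Decidable P) → ∀ i → P i → 0 < count P?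
count-pos P? i p = ≤-trans (s≤s z≤n) (count-mono-< {P = λ _ → ⊥} (λ _ → no λ ()) P? (λ _ ()) i p λ ())

count-witness : ∀ {n} {P : Pred (Fin n) 0ℓ} (P? : Decidable P) → 0 < count P? → ∃ P
count-witness {suc n} P? pos with P? zero
... | yes p = zero , p
... | no _ with count-witness (P? ∘ suc) pos
...   | i , p = suc i , p

count-∪-∩ : ∀ {n} {P Q : Pred (Fin n) 0ℓ} (P? : Decidable P) (Q? : Decidable Q) →
            count (λ i → P? i ⊎-dec Q? i) + count (λ i → P? i ×-dec Q? i) ≡ count P? + count Q?
count-∪-∩ {zero} P? Q? = refl
count-∪-∩ {suc n} P? Q? with P? zero | Q? zero | count-∪-∩ (P? ∘ suc) (Q? ∘ suc)
... | yes _ | yes _ | ih = cong suc (trans (+-suc _ _) (trans (cong suc ih) (sym (+-suc _ _))))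
... | yes _ | no _ | ih = cong suc ih
... | no _ | yes _ | ih = trans (cong suc ih) (sym (+-suc _ _))
... | no _ | no _ | ih = ih

count-∪-≤ : ∀ {n} {P Q : Pred (Fin n) 0ℓ} (P? : Decidable P) (Q? : Decidable Q) →
            count (λ i → P? i ⊎-dec Q? i) ≤ count P? + count Q?
count-∪-≤ P? Q? = ≤-trans (m≤m+n _ _) (≤-reflexive (count-∪-∩ P? Q?))

count-disjoint-∪ : ∀ {n} {P Q : Pred (Fin n) 0ℓ} (P? : Decidable P) (Q? : Decidable Q) →
                   (∀ i → P i → ¬ Q i) → count (λ i → P? i ⊎-dec Q? i) ≡ count P? + count Q?
count-disjoint-∪ P? Q? disjoint = begin
  count (λ i → P? i ⊎-dec Q? i)                                  ≡⟨ +-identityʳ _ ⟨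
  count (λ i → P? i ⊎-dec Q? i) + 0                              ≡⟨ cong (count (λ i → P? i ⊎-dec Q? i) +_) no-common ⟨
  count (λ i → P? i ⊎-dec Q? i) + count (λ i → P? i ×-dec Q? i)  ≡⟨ count-∪-∩ P? Q? ⟩
  count P? + count Q?                                            ∎
  where
  open ≡-Reasoning
  no-common : count (λ i → P? i ×-dec Q? i) ≡ 0
  no-common = count-empty (λ i → P? i ×-dec Q? i) λ i (p , q) → disjoint i p q

count-split : ∀ {n} {P Q : Pred (Fin n) 0ℓ} (P? : Decidable P) (Q? : Decidable Q) →
              count P? ≡ count (λ i → P? i ×-dec Q? i) + count (λ i → P? i ×-dec ¬? (Q? i))
count-split {P = P} {Q = Q} P? Q? =
  trans (count-cong P? (λ i → (P? i ×-dec Q? i) ⊎-dec (P? i ×-dec ¬? (Q? i))) cases forget)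
        (count-disjoint-∪ (λ i → P? i ×-dec Q? i) (λ i → P? i ×-dec ¬? (Q? i)) λ i (_ , q) (_ , ¬q) → ¬q q)
  where
  cases : ∀ i → P i → (P i × Q i) ⊎ (P i × ¬ Q i)
  cases i p with Q? i
  ... | yes q = inj₁ (p , q)
  ... | no ¬q = inj₂ (p , ¬q)
  forget : ∀ i → (P i × Q i) ⊎ (P i × ¬ Q i) → P i
  forget i (inj₁ (p , _)) = p
  forget i (inj₂ (p , _)) = p

count-singleton : ∀ {n} (a : Fin n) → count (_≟ a) ≡ 1
count-singleton {suc n} zero = cong suc (count-empty {n} (λ i → suc i ≟ zero) λ i ())
count-singleton {suc n} (suc a) =
  trans (count-cong (λ i → suc i ≟ suc a) (_≟ a) (λ _ → Fin.suc-injective) (λ _ → cong suc)) (count-singleton a)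

count-at : ∀ {n} {P : Pred (Fin n) 0ℓ} (P? : Decidable P) (a : Fin n) →
           count (λ i → P? i ×-dec i ≟ a) ≡ indicator (P? a)
count-at P? a with P? a
... | yes pa = trans (count-cong (λ i → P? i ×-dec i ≟ a) (_≟ a) (λ _ → proj₂) (λ { _ refl → pa , refl }))
                     (count-singleton a)
... | no ¬pa = count-empty (λ i → P? i ×-dec i ≟ a) λ { _ (pa , refl) → ¬pa pa }

count-point : ∀ {n} {P : Pred (Fin n) 0ℓ} (P? : Decidable P) (a : Fin n) →
              count P? ≡ indicator (P? a) + count (λ i → P? i ×-dec ¬? (i ≟ a))
count-point P? a =
  trans (count-split P? (_≟ a)) (cong (_+ count (λ i → P? i ×-dec ¬? (i ≟ a))) (count-at P? a))

except₂ : ∀ {n} {P : Pred (Fin n) 0ℓ} → Decidable P → Fin n → Fin n → ℕ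
except₂ P? a b = count (λ i → (P? i ×-dec ¬? (i ≟ a)) ×-dec ¬? (i ≟ b))

count-two-points : ∀ {n} {P : Pred (Fin n) 0ℓ} (P? : Decidable P) {a b : Fin n} → a ≢ b →
                   count P? ≡ indicator (P? a) + (indicator (P? b) + except₂ P? a b)
count-two-points P? {a} {b} a≢b = begin
  count P?
    ≡⟨ count-point P? a ⟩
  indicator (P? a) + count (λ i → P? i ×-dec ¬? (i ≟ a))
    ≡⟨ cong (indicator (P? a) +_) (count-point _ b) ⟩
  indicator (P? a) + (indicator (P? b ×-dec ¬? (b ≟ a)) + except₂ P? a b)
    ≡⟨ cong (λ x → indicator (P? a) + (x + except₂ P? a b)) at-b ⟩
  indicator (P? a) + (indicator (P? b) + except₂ P? a b) ∎
  where
  open ≡-Reasoning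
  at-b : indicator (P? b ×-dec ¬? (b ≟ a)) ≡ indicator (P? b)
  at-b = indicator-cong _ (P? b) proj₁ (λ p → p , a≢b ∘ sym)

except₂-cong : ∀ {n} {P Q : Pred (Fin n) 0ℓ} (P? : Decidable P) (Q? : Decidable Q) (a b : Fin n) →
               (∀ i → i ≢ a → i ≢ b → P i → Q i) → (∀ i → i ≢ a → i ≢ b → Q i → P i) →
               except₂ P? a b ≡ except₂ Q? a b
except₂-cong {n} P? Q? a b P⊆Q Q⊆P =
  count-cong {n} _ _ (λ i ((p , i≢a) , i≢b) → (P⊆Q i i≢a i≢b p , i≢a) , i≢b)
                     (λ i ((q , i≢a) , i≢b) → (Q⊆P i i≢a i≢b q , i≢a) , i≢b)

count-image : ∀ {k n} (a : Fin k → Fin n) → count (λ v → Fin.any? (λ t → a t ≟ v)) ≤ k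
count-image {zero} {n} a = ≤-reflexive (count-empty {n} (λ v → Fin.any? (λ t → a t ≟ v)) λ { v (() , _) })
count-image {suc k} {n} a = begin
  count (λ v → Fin.any? (λ t → a t ≟ v))                          ≤⟨ count-mono {n} _ _ head-or-tail ⟩
  count (λ v → a zero ≟ v ⊎-dec Fin.any? (λ t → a (suc t) ≟ v))   ≤⟨ count-∪-≤ (λ v → a zero ≟ v) _ ⟩
  count (λ v → a zero ≟ v) + count (λ v → Fin.any? (λ t → a (suc t) ≟ v))
                                                                  ≤⟨ +-mono-≤ (≤-reflexive head) (count-image (a ∘ suc)) ⟩
  suc k                                                           ∎
  where
  open ≤-Reasoning
  head-or-tail : ∀ v → (∃ λ t → a t ≡ v) → a zero ≡ v ⊎ (∃ λ t → a (suc t) ≡ v)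
  head-or-tail v (zero , e) = inj₁ e
  head-or-tail v (suc t , e) = inj₂ (t , e)
  head : count (λ v → a zero ≟ v) ≡ 1
  head = trans (count-cong (λ v → a zero ≟ v) (_≟ a zero) (λ _ → sym) (λ _ → sym)) (count-singleton (a zero))

swap-left : ∀ {n} (a b : Fin n) → swap a b a ≡ b
swap-left a b with a ≟ a
... | yes _ = refl
... | no a≢a = ⊥-elim (a≢a refl)

swap-right : ∀ {n} (a b : Fin n) → swap a b b ≡ a
swap-right a b with b ≟ a
... | yes b≡a = b≡a
... | no _ with b ≟ b
...   | yes _ = refl
...   | no b≢b = ⊥-elim (b≢b refl)

swap-other : ∀ {n} (a b i : Fin n) → i ≢ a → i ≢ b → swap a b i ≡ i
swap-other a b i i≢a i≢b with i ≟ a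
... | yes i≡a = ⊥-elim (i≢a i≡a)
... | no _ with i ≟ b
...   | yes i≡b = ⊥-elim (i≢b i≡b)
...   | no _ = refl

swap-involutive : ∀ {n} (a b i : Fin n) → swap a b (swap a b i) ≡ i
swap-involutive a b i with i ≟ a
... | yes i≡a = trans (swap-right a b) (sym i≡a)
... | no i≢a with i ≟ b
...   | yes i≡b = trans (swap-left a b) (sym i≡b)
...   | no i≢b = swap-other a b i i≢a i≢b

swap-sym : ∀ {n} (a b i : Fin n) → swap a b i ≡ swap b a i
swap-sym a b i = by-cases (i ≟ a) (i ≟ b)
  where
  by-cases : Dec (i ≡ a) → Dec (i ≡ b) → swap a b i ≡ swap b a i
  by-cases (yes refl) _ = trans (swap-left i b) (sym (swap-right b i))
  by-cases (no _) (yes refl) = trans (swap-right a i) (sym (swap-left i a))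
  by-cases (no i≢a) (no i≢b) = trans (swap-other a b i i≢a i≢b) (sym (swap-other b a i i≢b i≢a))

swap-self : ∀ {n} (a i : Fin n) → swap a a i ≡ i
swap-self a i = by-cases (i ≟ a)
  where
  by-cases : Dec (i ≡ a) → swap a a i ≡ i
  by-cases (yes refl) = swap-left i i
  by-cases (no i≢a) = swap-other a a i i≢a i≢a

count-swap : ∀ {n} {P : Pred (Fin n) 0ℓ} (P? : Decidable P) (a b : Fin n) → count (P? ∘ swap a b) ≡ count P?
count-swap {P = P} P? a b with a ≟ b
... | yes refl = count-cong (P? ∘ swap a a) P? (λ i → subst P (swap-self a i)) (λ i → subst P (sym (swap-self a i)))
... | no a≢b = begin
  count (P? ∘ swap a b)
    ≡⟨ count-two-points (P? ∘ swap a b) a≢b ⟩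
  indicator (P? (swap a b a)) + (indicator (P? (swap a b b)) + except₂ (P? ∘ swap a b) a b)
    ≡⟨ cong₂ (λ x y → x + (y + except₂ (P? ∘ swap a b) a b)) at-a at-b ⟩
  indicator (P? b) + (indicator (P? a) + except₂ (P? ∘ swap a b) a b)
    ≡⟨ x∙yz≈y∙xz +-commutativeSemigroup (indicator (P? b)) (indicator (P? a)) _ ⟩
  indicator (P? a) + (indicator (P? b) + except₂ (P? ∘ swap a b) a b)
    ≡⟨ cong (λ x → indicator (P? a) + (indicator (P? b) + x)) rest ⟩
  indicator (P? a) + (indicator (P? b) + except₂ P? a b)
    ≡⟨ count-two-points P? a≢b ⟨
  count P? ∎
  where
  open ≡-Reasoning
  at-a : indicator (P? (swap a b a)) ≡ indicator (P? b)
  at-a = cong (indicator ∘ P?) (swap-left a b)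
  at-b : indicator (P? (swap a b b)) ≡ indicator (P? a)
  at-b = cong (indicator ∘ P?) (swap-right a b)
  rest : except₂ (P? ∘ swap a b) a b ≡ except₂ P? a b
  rest = except₂-cong (P? ∘ swap a b) P? a b (λ i i≢a i≢b → subst P (swap-other a b i i≢a i≢b))
                                             (λ i i≢a i≢b → subst P (sym (swap-other a b i i≢a i≢b)))

length-filter-tabulate : ∀ {n} {A : Set} {P : Pred A 0ℓ} (P? : Decidable P) (f : Fin n → A) →
                         length (filter P? (tabulate f)) ≡ count (P? ∘ f)
length-filter-tabulate {zero} P? f = refl
length-filter-tabulate {suc n} P? f with P? (f zero)
... | yes _ = cong suc (length-filter-tabulate P? (f ∘ suc))
... | no _ = length-filter-tabulate P? (f ∘ suc)

fiberSize≡count : ∀ {n m} (σ : Fin n → Fin m) (y : Fin m) → fiberSize σ y ≡ count (λ i → σ i ≟ y)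
fiberSize≡count σ y = length-filter-tabulate (λ i → σ i ≟ y) (λ i → i)

fibre-count : ∀ {n m} {c : Fin m → ℕ} (s : FSVertex n m c) → ∀ y → count (λ i → proj₁ s i ≟ y) ≡ c y
fibre-count (σ , fibres) y = trans (sym (fiberSize≡count σ y)) (fibres y)

from-counts : ∀ {n m} {c : Fin m → ℕ} (σ : Fin n → Fin m) → (∀ y → count (λ i → σ i ≟ y) ≡ c y) →
              FSVertex n m c
from-counts σ counts = σ , λ y → trans (fiberSize≡count σ y) (counts y)

prependBlock : ∀ a {b m} → (Fin b → Fin m) → Fin (a + b) → Fin (suc m)
prependBlock zero σ i = suc (σ i)
prependBlock (suc a) σ zero = zero
prependBlock (suc a) σ (suc i) = prependBlock a σ i

count-prependBlock-zero : ∀ a {b m} (σ : Fin b → Fin m) → count (λ i → prependBlock a σ i ≟ zero) ≡ a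
count-prependBlock-zero zero {b} σ = count-empty {b} (λ i → suc (σ i) ≟ zero) λ i ()
count-prependBlock-zero (suc a) σ = cong suc (count-prependBlock-zero a σ)

count-prependBlock-suc : ∀ a {b m} (σ : Fin b → Fin m) (y : Fin m) →
                         count (λ i → prependBlock a σ i ≟ suc y) ≡ count (λ i → σ i ≟ y)
count-prependBlock-suc zero σ y =
  count-cong (λ i → suc (σ i) ≟ suc y) (λ i → σ i ≟ y) (λ _ → Fin.suc-injective) (λ _ → cong suc)
count-prependBlock-suc (suc a) σ y = count-prependBlock-suc a σ y

blocks : ∀ {m} (c : Fin m → ℕ) → Fin (sum (tabulate c)) → Fin m
blocks {suc m} c = prependBlock (c zero) (blocks (c ∘ suc))

count-blocks : ∀ {m} (c : Fin m → ℕ) y → count (λ i → blocks c i ≟ y) ≡ c y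
count-blocks {suc m} c zero = count-prependBlock-zero (c zero) (blocks (c ∘ suc))
count-blocks {suc m} c (suc y) =
  trans (count-prependBlock-suc (c zero) (blocks (c ∘ suc)) y) (count-blocks (c ∘ suc) y)

configuration : ∀ {n m} (c : Fin m → ℕ) → totalMult c ≡ n → FSVertex n m c
configuration c total≡n with trans (sym (cong sum (map-tabulate (λ i → i) c))) total≡n
... | refl = from-counts (blocks c) (count-blocks c)

swapped : ∀ {n m} {c : Fin m → ℕ} → FSVertex n m c → Fin n → Fin n → FSVertex n m c
swapped s a b =
  from-counts (proj₁ s ∘ swap a b) λ y → trans (count-swap (λ i → proj₁ s i ≟ y) a b) (fibre-count s y)

place : ∀ {n m} {c : Fin m → ℕ} (s : FSVertex n m c) → ∀ y → 0 < c y → (r : Fin n) →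
        Σ (FSVertex n m c) λ t → proj₁ t r ≡ y
place s y c>0 r with count-witness (λ i → proj₁ s i ≟ y) (subst (0 <_) (sym (fibre-count s y)) c>0)
... | p , sp≡y = swapped s p r , trans (cong (proj₁ s) (swap-right p r)) sp≡y

module Gather {n m} {c : Fin m → ℕ} (y : Fin m) {R : Pred (Fin n) 0ℓ} (R? : Decidable R)
              (room : c y ≤ count R?) where

  misplaced : FSVertex n m c → ℕ
  misplaced (σ , _) = count (λ i → σ i ≟ y ×-dec ¬? (R? i))

  free-slot : ∀ {N} (s : FSVertex n m c) → misplaced s ≡ suc N → ∃ λ r → R r × proj₁ s r ≢ y
  free-slot {N} s@(σ , _) misplaced≡ =
    count-witness (λ i → R? i ×-dec ¬? (σ i ≟ y)) (+-cancelˡ-≤ placed 1 _ (begin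
    placed + 1                                      ≤⟨ +-monoʳ-≤ placed (s≤s z≤n) ⟩
    placed + suc N                                  ≡⟨ cong₂ _+_ placed-comm misplaced≡ ⟨
    count (λ i → σ i ≟ y ×-dec R? i) + misplaced s  ≡⟨ count-split (λ i → σ i ≟ y) R? ⟨
    count (λ i → σ i ≟ y)                           ≡⟨ fibre-count s y ⟩
    c y                                             ≤⟨ room ⟩
    count R?                                        ≡⟨ count-split R? (λ i → σ i ≟ y) ⟩
    placed + count (λ i → R? i ×-dec ¬? (σ i ≟ y))  ∎))
    where
    open ≤-Reasoning
    placed : ℕ
    placed = count (λ i → R? i ×-dec σ i ≟ y)
    placed-comm : count (λ i → σ i ≟ y ×-dec R? i) ≡ placed
    placed-comm = count-cong (λ i → σ i ≟ y ×-dec R? i) (λ i → R? i ×-dec σ i ≟ y)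
                             (λ _ (p , q) → q , p) (λ _ (p , q) → q , p)

  gather-step : ∀ {N} (s : FSVertex n m c) → misplaced s ≡ suc N →
                Σ (FSVertex n m c) λ t → misplaced t ≡ N
  gather-step {N} s@(σ , _) misplaced≡
    with count-witness (λ i → σ i ≟ y ×-dec ¬? (R? i)) (subst (0 <_) (sym misplaced≡) (s≤s z≤n))
       | free-slot s misplaced≡
  ... | v , σv≡y , ¬Rv | r , Rr , σr≢y = swapped s v r , suc-injective (begin
    suc (count M′?)
      ≡⟨ cong suc (count-two-points M′? v≢r) ⟩
    suc (indicator (M′? v) + (indicator (M′? r) + except₂ M′? v r))
      ≡⟨ cong₂ (λ x z → suc (x + (z + except₂ M′? v r))) τv-placed τr-placed ⟩
    suc (except₂ M′? v r)
      ≡⟨ cong suc (except₂-cong M′? M? v r agree-off agree-off′) ⟩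
    suc (except₂ M? v r)
      ≡⟨ cong₂ (λ x z → x + (z + except₂ M? v r)) σv-misplaced σr-placed ⟨
    indicator (M? v) + (indicator (M? r) + except₂ M? v r)
      ≡⟨ count-two-points M? v≢r ⟨
    misplaced s
      ≡⟨ misplaced≡ ⟩
    suc N ∎)
    where
    open ≡-Reasoning
    τ : Fin n → Fin m
    τ = σ ∘ swap v r
    M? : Decidable (λ i → σ i ≡ y × ¬ R i)
    M? i = σ i ≟ y ×-dec ¬? (R? i)
    M′? : Decidable (λ i → τ i ≡ y × ¬ R i)
    M′? i = τ i ≟ y ×-dec ¬? (R? i)
    v≢r : v ≢ r
    v≢r refl = ¬Rv Rr
    τv-placed : indicator (M′? v) ≡ 0
    τv-placed = indicator-no (M′? v) λ (τv≡y , _) → σr≢y (trans (sym (cong σ (swap-left v r))) τv≡y)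
    τr-placed : indicator (M′? r) ≡ 0
    τr-placed = indicator-no (M′? r) λ (_ , ¬Rr) → ¬Rr Rr
    σv-misplaced : indicator (M? v) ≡ 1
    σv-misplaced = indicator-yes (M? v) (σv≡y , ¬Rv)
    σr-placed : indicator (M? r) ≡ 0
    σr-placed = indicator-no (M? r) λ (_ , ¬Rr) → ¬Rr Rr
    agree-off : ∀ i → i ≢ v → i ≢ r → τ i ≡ y × ¬ R i → σ i ≡ y × ¬ R i
    agree-off i i≢v i≢r (τi≡y , ¬Ri) = trans (sym (cong σ (swap-other v r i i≢v i≢r))) τi≡y , ¬Ri
    agree-off′ : ∀ i → i ≢ v → i ≢ r → σ i ≡ y × ¬ R i → τ i ≡ y × ¬ R i
    agree-off′ i i≢v i≢r (σi≡y , ¬Ri) = trans (cong σ (swap-other v r i i≢v i≢r)) σi≡y , ¬Ri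

  gather-from : ∀ N (s : FSVertex n m c) → misplaced s ≡ N →
                Σ (FSVertex n m c) λ t → ∀ v → proj₁ t v ≡ y → R v
  gather-from zero s@(σ , _) none = s , placed
    where
    placed : ∀ v → σ v ≡ y → R v
    placed v σv≡y with R? v
    ... | yes Rv = Rv
    ... | no ¬Rv = ⊥-elim (<-irrefl (sym none) (count-pos (λ i → σ i ≟ y ×-dec ¬? (R? i)) v (σv≡y , ¬Rv)))
  gather-from (suc N) s misplaced≡ =
    let t , misplaced≡′ = gather-step s misplaced≡ in gather-from N t misplaced≡′

gather : ∀ {n m} {c : Fin m → ℕ} (s : FSVertex n m c) → ∀ y {R : Pred (Fin n) 0ℓ} (R? : Decidable R) →
         c y ≤ count R? →
         Σ (FSVertex n m c) λ t → ∀ v → proj₁ t v ≡ y → R v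
gather s y R? room = Gather.gather-from y R? room _ s refl

star-move : ∀ {n m} {X : SimpleGraph n} {ctr : Fin m} {c : Fin m → ℕ} {s t : FSVertex n m c} →
            FSAdj X (StarAdj ctr) c s t →
            ∃ λ u → ∃ λ w → E X u w × proj₁ s w ≡ ctr × proj₁ s u ≢ ctr ×
                            (∀ i → proj₁ t i ≡ proj₁ s (swap u w i))
star-move {X = X} {s = σ , _} {τ , _} (a , b , e , centre-at , σ≗τ∘swap) with centre-at
... | inj₂ (σb≡ctr , σa≢ctr) = a , b , e , σb≡ctr , σa≢ctr , τ≗σ∘swap
  where
  τ≗σ∘swap : ∀ i → τ i ≡ σ (swap a b i)
  τ≗σ∘swap i = sym (trans (σ≗τ∘swap (swap a b i)) (cong τ (swap-involutive a b i)))
... | inj₁ (σa≡ctr , σb≢ctr) = b , a , E-sym X e , σa≡ctr , σb≢ctr , τ≗σ∘swap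
  where
  τ≗σ∘swap : ∀ i → τ i ≡ σ (swap b a i)
  τ≗σ∘swap i =
    sym (trans (σ≗τ∘swap (swap b a i)) (cong τ (trans (swap-sym a b (swap b a i)) (swap-involutive b a i))))

preserved-along : ∀ {I : Set} {T : I → I → Set} (P : I → Set) → (∀ {i j} → T i j → P i → P j) →
                  ∀ {i j} → Star T i j → P i → P j
preserved-along P step = fold (λ i j → P i → P j) (λ t rest → rest ∘ step t) (λ p → p)

module Bridge {n ℓ : ℕ} (X : SimpleGraph n) (bridge : KBridge X (suc (suc ℓ)))
              (InA? : Decidable (Star (KBridge.E' bridge) (KBridge.a bridge zero))) where

  open KBridge bridge

  k : ℕ
  k = suc (suc ℓ)

  end : Fin k
  end = fromℕ (suc ℓ)

  toℕ-end : toℕ end ≡ suc ℓ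
  toℕ-end = Fin.toℕ-fromℕ (suc ℓ)

  a-injective : ∀ {s t} → a s ≡ a t → s ≡ t
  a-injective = distinct _ _

  a-cong-toℕ : ∀ {s t} → toℕ s ≡ toℕ t → a s ≡ a t
  a-cong-toℕ = cong a ∘ Fin.toℕ-injective

  data Position (t : Fin k) : Set where
    first    : t ≡ zero → Position t
    interior : 0 < toℕ t → suc (toℕ t) < k → Position t
    final    : toℕ t ≡ suc ℓ → Position t

  position : ∀ t → Position t
  position zero = first refl
  position (suc t) with toℕ t ℕ.≟ ℓ
  ... | yes t≡ℓ = final (cong suc t≡ℓ)
  ... | no t≢ℓ = interior (s≤s z≤n) (s≤s (s≤s (≤∧≢⇒< (ℕ.s≤s⁻¹ (Fin.toℕ<n t)) t≢ℓ)))

  Adjacent : Fin k → Fin k → Set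
  Adjacent s t = toℕ s ≡ suc (toℕ t) ⊎ suc (toℕ s) ≡ toℕ t

  Adjacent-sym : ∀ {s t} → Adjacent s t → Adjacent t s
  Adjacent-sym = Sum.swap ∘ Sum.map sym sym

  E'-sym : ∀ {u v} → E' u v → E' v u
  E'-sym (uv , ¬Iu , ¬Iv , ¬Puv) =
    E-sym X uv , ¬Iv , ¬Iu , λ (i , j , j≡i+1 , ends) → ¬Puv (i , j , j≡i+1 , Sum.swap ends)

  ¬Internal-reachable : ∀ {u v} → Star E' u v → ¬ Internal u → ¬ Internal v
  ¬Internal-reachable ε ¬Iu = ¬Iu
  ¬Internal-reachable ((_ , _ , ¬Iw , _) ◅ path) _ = ¬Internal-reachable path ¬Iw

  ¬Internal-a-zero : ¬ Internal (a zero)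
  ¬Internal-a-zero (i , 0<i , _ , ai≡a0) with a-injective ai≡a0
  ... | refl = <-irrefl refl 0<i

  ¬Internal-a-end : ¬ Internal (a end)
  ¬Internal-a-end (i , _ , i+1<k , ai≡aend) with a-injective ai≡aend
  ... | refl = <-irrefl (cong suc toℕ-end) i+1<k

  InA : Fin n → Set
  InA = Star E' (a zero)

  InA⇒¬Internal : ∀ {v} → InA v → ¬ Internal v
  InA⇒¬Internal reach = ¬Internal-reachable reach ¬Internal-a-zero

  a-end∉A : ¬ InA (a end)
  a-end∉A = proj₁ (separated zero end refl (cong suc toℕ-end))

  A-nontrivial : ∃ λ w → w ≢ a zero × InA w
  A-nontrivial = proj₁ (proj₂ (separated zero end refl (cong suc toℕ-end)))

  B-nontrivial : ∃ λ w → w ≢ a end × Star E' (a end) w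
  B-nontrivial = proj₂ (proj₂ (separated zero end refl (cong suc toℕ-end)))

  InA-a⇒zero : ∀ {t} → InA (a t) → t ≡ zero
  InA-a⇒zero {t} reach with position t
  ... | first t≡0 = t≡0
  ... | interior 0<t t+1<k = ⊥-elim (InA⇒¬Internal reach (t , 0<t , t+1<k , refl))
  ... | final t≡end = ⊥-elim (a-end∉A (subst InA (a-cong-toℕ (trans t≡end (sym toℕ-end))) reach))

  a-in-A : ∀ {r u} → a r ≡ u → InA u → u ≡ a zero
  a-in-A ar≡u u∈A = trans (sym ar≡u) (cong a (InA-a⇒zero (subst InA (sym ar≡u) u∈A)))

  Internal? : Decidable Internal
  Internal? v = Fin.any? λ i → 0 ℕ.<? toℕ i ×-dec suc (toℕ i) ℕ.<? k ×-dec a i ≟ v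

  PathEdge? : ∀ u v → Dec (PathEdge u v)
  PathEdge? u v = Fin.any? λ i → Fin.any? λ j →
    toℕ j ℕ.≟ suc (toℕ i) ×-dec ((a i ≟ u ×-dec a j ≟ v) ⊎-dec (a i ≟ v ×-dec a j ≟ u))

  data EdgeKind (u w : Fin n) : Set where
    from-internal : Internal u → EdgeKind u w
    to-internal   : Internal w → EdgeKind u w
    along-path    : PathEdge u w → EdgeKind u w
    off-path      : E' u w → EdgeKind u w

  edgeKind : ∀ {u w} → E X u w → EdgeKind u w
  edgeKind {u} {w} uw with Internal? u | Internal? w | PathEdge? u w
  ... | yes Iu | _ | _ = from-internal Iu
  ... | no _ | yes Iw | _ = to-internal Iw
  ... | no _ | no _ | yes Puw = along-path Puw
  ... | no ¬Iu | no ¬Iw | no ¬Puw = off-path (uw , ¬Iu , ¬Iw , ¬Puw)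

  data PathNeighbour (t : Fin k) (w : Fin n) : Set where
    on-path : ∀ s → a s ≡ w → Adjacent s t → PathNeighbour t w
    into-A  : t ≡ zero → InA w → PathNeighbour t w
    beyond  : toℕ t ≡ suc ℓ → ¬ InA w → (∀ s → a s ≢ w) → PathNeighbour t w

  pathNeighbour : ∀ {t w} → E X (a t) w → PathNeighbour t w
  pathNeighbour {t} {w} e with edgeKind e
  ... | from-internal (i , 0<i , i+1<k , ai≡at) with a-injective ai≡at
  ...   | refl with onlyNbrs i 0<i i+1<k w e
  ...     | j , j∼i , aj≡w = on-path j aj≡w j∼i
  pathNeighbour {t} {w} e | to-internal (s , 0<s , s+1<k , as≡w)
    with onlyNbrs s 0<s s+1<k (a t) (subst (λ x → E X x (a t)) (sym as≡w) (E-sym X e))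
  ... | j , j∼s , aj≡at with a-injective aj≡at
  ...   | refl = on-path s as≡w (Adjacent-sym j∼s)
  pathNeighbour {t} {w} e | along-path (i , j , j≡i+1 , inj₁ (ai≡at , aj≡w)) with a-injective ai≡at
  ... | refl = on-path j aj≡w (inj₁ j≡i+1)
  pathNeighbour {t} {w} e | along-path (i , j , j≡i+1 , inj₂ (ai≡w , aj≡at)) with a-injective aj≡at
  ... | refl = on-path i ai≡w (inj₂ (sym j≡i+1))
  pathNeighbour {t} {w} e | off-path e′@(_ , ¬It , ¬Iw , _) with position t
  ... | first refl = into-A refl (e′ ◅ ε)
  ... | interior 0<t t+1<k = ⊥-elim (¬It (t , 0<t , t+1<k , refl))
  ... | final t≡end = beyond t≡end w∉A w∉path
    where
    w∉A : ¬ InA w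
    w∉A reach = 0≢1+n (trans (sym (cong toℕ (InA-a⇒zero (reach ◅◅ (E'-sym e′ ◅ ε))))) t≡end)
    w∉path : ∀ s → a s ≢ w
    w∉path s as≡w with position s
    ... | first refl = w∉A (subst InA as≡w ε)
    ... | interior 0<s s+1<k = ¬Iw (s , 0<s , s+1<k , as≡w)
    ... | final s≡end with Fin.toℕ-injective {i = s} {j = t} (trans s≡end (sym t≡end))
    ...   | refl = irrefl X (subst (E X (a s)) (sym as≡w) e)

  A-neighbour : ∀ {u w} → InA u → E X u w → InA w ⊎ u ≡ a zero
  A-neighbour {u} {w} u∈A e with edgeKind e
  ... | from-internal Iu = ⊥-elim (InA⇒¬Internal u∈A Iu)
  ... | off-path e′ = inj₁ (u∈A ◅◅ (e′ ◅ ε))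
  ... | along-path (i , j , _ , inj₁ (ai≡u , _)) = inj₂ (a-in-A ai≡u u∈A)
  ... | along-path (i , j , _ , inj₂ (_ , aj≡u)) = inj₂ (a-in-A aj≡u u∈A)
  ... | to-internal (s , 0<s , s+1<k , as≡w)
    with onlyNbrs s 0<s s+1<k u (subst (λ x → E X x u) (sym as≡w) (E-sym X e))
  ...   | j , _ , aj≡u = inj₂ (a-in-A aj≡u u∈A)

  InA′ : Fin n → Set
  InA′ v = InA v × v ≢ a zero

  InA′? : Decidable InA′
  InA′? v = InA? v ×-dec ¬? (v ≟ a zero)

  OnPath : Fin n → Set
  OnPath v = ∃ λ t → a t ≡ v

  OnPath? : Decidable OnPath
  OnPath? v = Fin.any? λ t → a t ≟ v

  Outside : Fin n → Set
  Outside v = ¬ InA v × ¬ OnPath v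

  Outside? : Decidable Outside
  Outside? v = ¬? (InA? v) ×-dec ¬? (OnPath? v)

  classify : ∀ v → (InA′ v ⊎ Outside v) ⊎ OnPath v
  classify v with InA? v | v ≟ a zero | OnPath? v
  ... | yes v∈A | no v≢a0 | _ = inj₁ (inj₁ (v∈A , v≢a0))
  ... | yes _ | yes v≡a0 | _ = inj₂ (zero , sym v≡a0)
  ... | no _ | _ | yes v∈path = inj₂ v∈path
  ... | no v∉A | _ | no v∉path = inj₁ (inj₂ (v∉A , v∉path))

  vertices-bound : n ≤ count InA′? + count Outside? + k
  vertices-bound = begin
    n
      ≡⟨ count-full (λ v → (InA′? v ⊎-dec Outside? v) ⊎-dec OnPath? v) classify ⟨
    count (λ v → (InA′? v ⊎-dec Outside? v) ⊎-dec OnPath? v)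
      ≤⟨ count-∪-≤ (λ v → InA′? v ⊎-dec Outside? v) OnPath? ⟩
    count (λ v → InA′? v ⊎-dec Outside? v) + count OnPath?
      ≤⟨ +-mono-≤ (count-∪-≤ InA′? Outside?) (count-image a) ⟩
    count InA′? + count Outside? + k ∎
    where open ≤-Reasoning

  B-outside : Outside (proj₁ B-nontrivial)
  B-outside = w∉A , w∉path
    where
    w : Fin n
    w = proj₁ B-nontrivial
    w≢aend : w ≢ a end
    w≢aend = proj₁ (proj₂ B-nontrivial)
    aend↝w : Star E' (a end) w
    aend↝w = proj₂ (proj₂ B-nontrivial)
    w∉A : ¬ InA w
    w∉A w∈A = a-end∉A (w∈A ◅◅ reverse E'-sym aend↝w)
    w∉path : ¬ OnPath w
    w∉path (t , at≡w) with position t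
    ... | first refl = w∉A (subst InA at≡w ε)
    ... | interior 0<t t+1<k = ¬Internal-reachable aend↝w ¬Internal-a-end (t , 0<t , t+1<k , at≡w)
    ... | final t≡end = w≢aend (trans (sym at≡w) (a-cong-toℕ (trans t≡end (sym toℕ-end))))

  Behind : ℕ → Fin n → Set
  Behind j v = InA′ v ⊎ ∃ λ s → toℕ s < j × a s ≡ v

  Behind? : ∀ j → Decidable (Behind j)
  Behind? j v = InA′? v ⊎-dec Fin.any? λ s → toℕ s ℕ.<? j ×-dec a s ≟ v

  ¬Behind-ahead : ∀ {s t : Fin k} → toℕ t ≤ toℕ s → ¬ Behind (toℕ t) (a s)
  ¬Behind-ahead t≤s (inj₁ (as∈A , as≢a0)) = as≢a0 (a-in-A refl as∈A)
  ¬Behind-ahead t≤s (inj₂ (r , r<t , ar≡as)) with a-injective ar≡as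
  ... | refl = <-irrefl refl (<-≤-trans r<t t≤s)

  Behind-suc⁻ : ∀ t v → Behind (suc (toℕ t)) v → Behind (toℕ t) v ⊎ v ≡ a t
  Behind-suc⁻ t v (inj₁ v∈A′) = inj₁ (inj₁ v∈A′)
  Behind-suc⁻ t v (inj₂ (s , s≤t , as≡v)) with toℕ s ℕ.≟ toℕ t
  ... | yes s≡t = inj₂ (trans (sym as≡v) (a-cong-toℕ s≡t))
  ... | no s≢t = inj₁ (inj₂ (s , ≤∧≢⇒< (ℕ.s≤s⁻¹ s≤t) s≢t , as≡v))

  Behind-suc⁺ : ∀ t v → Behind (toℕ t) v ⊎ v ≡ a t → Behind (suc (toℕ t)) v
  Behind-suc⁺ t v (inj₁ (inj₁ v∈A′)) = inj₁ v∈A′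
  Behind-suc⁺ t v (inj₁ (inj₂ (s , s<t , as≡v))) = inj₂ (s , m<n⇒m<1+n s<t , as≡v)
  Behind-suc⁺ t v (inj₂ refl) = inj₂ (t , ≤-refl , refl)

  ≢a-zero⇒0< : ∀ {t} → a t ≢ a zero → 0 < toℕ t
  ≢a-zero⇒0< {zero} at≢a0 = ⊥-elim (at≢a0 refl)
  ≢a-zero⇒0< {suc t} _ = s≤s z≤n

  Behind-closed : ∀ {t u w} → E X u w → u ≢ a t → w ≢ a t → Behind (toℕ t) u → Behind (toℕ t) w
  Behind-closed {t} {u} {w} e u≢at w≢at (inj₁ (u∈A , u≢a0)) with A-neighbour u∈A e | w ≟ a zero
  ... | inj₂ u≡a0 | _ = ⊥-elim (u≢a0 u≡a0)
  ... | inj₁ w∈A | no w≢a0 = inj₁ (w∈A , w≢a0)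
  ... | inj₁ w∈A | yes w≡a0 = inj₂ (zero , ≢a-zero⇒0< (λ at≡a0 → w≢at (trans w≡a0 (sym at≡a0))) , sym w≡a0)
  Behind-closed {t} {u} {w} e u≢at w≢at (inj₂ (s , s<t , as≡u))
    with pathNeighbour {s} {w} (subst (λ x → E X x w) (sym as≡u) e)
  ... | on-path r ar≡w (inj₁ r≡s+1) =
    inj₂ (r , ≤∧≢⇒< (subst (_≤ toℕ t) (sym r≡s+1) s<t) (λ r≡t → w≢at (trans (sym ar≡w) (a-cong-toℕ r≡t))) , ar≡w)
  ... | on-path r ar≡w (inj₂ r+1≡s) = inj₂ (r , <-trans (subst (toℕ r <_) r+1≡s ≤-refl) s<t , ar≡w)
  ... | into-A refl w∈A = inj₁ (w∈A , λ w≡a0 → irrefl X (subst₂ (E X) (sym as≡u) w≡a0 e))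
  ... | beyond s≡end _ _ = ⊥-elim (<-irrefl refl (≤-trans (s≤s (subst (_< toℕ t) s≡end s<t)) (Fin.toℕ<n t)))

  Behind-swap : ∀ {t u w} → E X u w → u ≢ a t → w ≢ a t →
                ∀ i → Behind (toℕ t) i → Behind (toℕ t) (swap u w i)
  Behind-swap {t} {u} {w} e u≢at w≢at i i∈S = by-cases (i ≟ u) (i ≟ w)
    where
    by-cases : Dec (i ≡ u) → Dec (i ≡ w) → Behind (toℕ t) (swap u w i)
    by-cases (yes refl) _ =
      subst (Behind (toℕ t)) (sym (swap-left u w)) (Behind-closed e u≢at w≢at i∈S)
    by-cases (no _) (yes refl) =
      subst (Behind (toℕ t)) (sym (swap-right u w)) (Behind-closed (E-sym X e) w≢at u≢at i∈S)
    by-cases (no i≢u) (no i≢w) =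
      subst (Behind (toℕ t)) (sym (swap-other u w i i≢u i≢w)) i∈S

  module Tokens {m} (ctr : Fin m) where

    centresBehind : (Fin n → Fin m) → ℕ → ℕ
    centresBehind σ j = count (λ i → Behind? j i ×-dec σ i ≟ ctr)

    ASided : (Fin n → Fin m) → Fin n → Set
    ASided σ v = InA′ v ⊎ ∃ λ t → a t ≡ v × toℕ t < centresBehind σ (toℕ t)

    centresBehind-cong : ∀ {ρ ρ′} → (∀ i → ρ i ≡ ρ′ i) → ∀ j → centresBehind ρ j ≡ centresBehind ρ′ j
    centresBehind-cong {ρ} {ρ′} ρ≗ρ′ j =
      count-cong (λ i → Behind? j i ×-dec ρ i ≟ ctr) (λ i → Behind? j i ×-dec ρ′ i ≟ ctr)
                 (λ i (i∈S , ρi≡ctr) → i∈S , trans (sym (ρ≗ρ′ i)) ρi≡ctr)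
                 (λ i (i∈S , ρ′i≡ctr) → i∈S , trans (ρ≗ρ′ i) ρ′i≡ctr)

    ASided-cong : ∀ {ρ ρ′} → (∀ i → ρ i ≡ ρ′ i) → ∀ {v} → ASided ρ v → ASided ρ′ v
    ASided-cong ρ≗ρ′ (inj₁ v∈A′) = inj₁ v∈A′
    ASided-cong ρ≗ρ′ (inj₂ (t , at≡v , t<c)) =
      inj₂ (t , at≡v , subst (toℕ t <_) (centresBehind-cong ρ≗ρ′ (toℕ t)) t<c)

    centresBehind-suc : ∀ t (ρ ρ′ : Fin n → Fin m) → (∀ i → Behind (toℕ t) i → ρ i ≡ ρ′ i) → ρ (a t) ≡ ctr →
                        centresBehind ρ (suc (toℕ t)) ≡ suc (centresBehind ρ′ (toℕ t))
    centresBehind-suc t ρ ρ′ agree ρat≡ctr = begin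
      centresBehind ρ (suc (toℕ t))
        ≡⟨ count-cong (λ i → Behind? (suc (toℕ t)) i ×-dec ρ i ≟ ctr) (λ i → Old? i ⊎-dec i ≟ a t) split join ⟩
      count (λ i → Old? i ⊎-dec i ≟ a t)
        ≡⟨ count-disjoint-∪ Old? (_≟ a t) (λ { i (i∈S , _) refl → ¬Behind-ahead ≤-refl i∈S }) ⟩
      count Old? + count (_≟ a t)
        ≡⟨ cong₂ _+_ (count-cong Old? (λ i → Behind? (toℕ t) i ×-dec ρ′ i ≟ ctr)
                        (λ i (i∈S , ρi≡ctr) → i∈S , trans (sym (agree i i∈S)) ρi≡ctr)
                        (λ i (i∈S , ρ′i≡ctr) → i∈S , trans (agree i i∈S) ρ′i≡ctr))
                     (count-singleton (a t)) ⟩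
      centresBehind ρ′ (toℕ t) + 1
        ≡⟨ +-comm _ 1 ⟩
      suc (centresBehind ρ′ (toℕ t)) ∎
      where
      open ≡-Reasoning
      Old? : Decidable (λ i → Behind (toℕ t) i × ρ i ≡ ctr)
      Old? i = Behind? (toℕ t) i ×-dec ρ i ≟ ctr
      split : ∀ i → Behind (suc (toℕ t)) i × ρ i ≡ ctr → (Behind (toℕ t) i × ρ i ≡ ctr) ⊎ i ≡ a t
      split i (i∈S , ρi≡ctr) = Sum.map₁ (_, ρi≡ctr) (Behind-suc⁻ t i i∈S)
      join : ∀ i → (Behind (toℕ t) i × ρ i ≡ ctr) ⊎ i ≡ a t → Behind (suc (toℕ t)) i × ρ i ≡ ctr
      join i (inj₁ (i∈S , ρi≡ctr)) = Behind-suc⁺ t i (inj₁ i∈S) , ρi≡ctr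
      join i (inj₂ refl) = Behind-suc⁺ t i (inj₂ refl) , ρat≡ctr

    centresBehind-swap : ∀ σ {t u w} → E X u w → u ≢ a t → w ≢ a t →
                         centresBehind (σ ∘ swap u w) (toℕ t) ≡ centresBehind σ (toℕ t)
    centresBehind-swap σ {t} {u} {w} e u≢at w≢at =
      trans (count-cong (λ i → Behind? (toℕ t) i ×-dec σ (swap u w i) ≟ ctr) (C? ∘ swap u w)
               (λ i (i∈S , σ′i≡ctr) → Behind-swap e u≢at w≢at i i∈S , σ′i≡ctr)
               (λ i (i′∈S , σ′i≡ctr) → subst (Behind (toℕ t)) (swap-involutive u w i)
                                             (Behind-swap e u≢at w≢at (swap u w i) i′∈S) , σ′i≡ctr))
            (count-swap C? u w)
      where
      C? : Decidable (λ i → Behind (toℕ t) i × σ i ≡ ctr)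
      C? i = Behind? (toℕ t) i ×-dec σ i ≟ ctr

    module Move (σ : Fin n → Fin m) (centres : count (λ i → σ i ≟ ctr) ≡ k)
                {u w : Fin n} (e : E X u w) (σw≡ctr : σ w ≡ ctr) (σu≢ctr : σ u ≢ ctr) where

      τ : Fin n → Fin m
      τ = σ ∘ swap u w

      τu≡ctr : τ u ≡ ctr
      τu≡ctr = trans (cong σ (swap-left u w)) σw≡ctr

      τ≡σ-off : ∀ i → i ≢ u → i ≢ w → τ i ≡ σ i
      τ≡σ-off i i≢u i≢w = cong σ (swap-other u w i i≢u i≢w)

      from-A : InA′ u → ASided τ w
      from-A (u∈A , u≢a0) with A-neighbour u∈A e | w ≟ a zero
      ... | inj₂ u≡a0 | _ = ⊥-elim (u≢a0 u≡a0)
      ... | inj₁ w∈A | no w≢a0 = inj₁ (w∈A , w≢a0)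
      ... | inj₁ w∈A | yes w≡a0 =
        inj₂ (zero , sym w≡a0 , count-pos (λ i → Behind? 0 i ×-dec τ i ≟ ctr) u (inj₁ (u∈A , u≢a0) , τu≡ctr))

      forward : ∀ {t s : Fin k} → a t ≡ u → a s ≡ w → toℕ s ≡ suc (toℕ t) →
                toℕ t < centresBehind σ (toℕ t) → toℕ s < centresBehind τ (toℕ s)
      forward {t} {s} at≡u as≡w s≡t+1 t<c = subst (λ j → j < centresBehind τ j) (sym s≡t+1) (begin-strict
        suc (toℕ t)                    <⟨ s≤s t<c ⟩
        suc (centresBehind σ (toℕ t))  ≡⟨ centresBehind-suc t τ σ agree (subst (λ x → τ x ≡ ctr) (sym at≡u) τu≡ctr) ⟨
        centresBehind τ (suc (toℕ t))  ∎)
        where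
        open ≤-Reasoning
        agree : ∀ i → Behind (toℕ t) i → τ i ≡ σ i
        agree i i∈S = τ≡σ-off i
          (λ { refl → ¬Behind-ahead ≤-refl (subst (Behind (toℕ t)) (sym at≡u) i∈S) })
          (λ { refl → ¬Behind-ahead (subst (toℕ t ≤_) (sym s≡t+1) (n≤1+n _)) (subst (Behind (toℕ t)) (sym as≡w) i∈S) })

      backward : ∀ {t s : Fin k} → a t ≡ u → a s ≡ w → suc (toℕ s) ≡ toℕ t →
                 toℕ t < centresBehind σ (toℕ t) → toℕ s < centresBehind τ (toℕ s)
      backward {t} {s} at≡u as≡w s+1≡t t<c = ≤-pred (begin-strict
        suc (toℕ s)                    ≡⟨ s+1≡t ⟩
        toℕ t                          <⟨ t<c ⟩
        centresBehind σ (toℕ t)        ≡⟨ cong (centresBehind σ) s+1≡t ⟨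
        centresBehind σ (suc (toℕ s))  ≡⟨ centresBehind-suc s σ τ agree (subst (λ x → σ x ≡ ctr) (sym as≡w) σw≡ctr) ⟩
        suc (centresBehind τ (toℕ s))  ∎)
        where
        open ≤-Reasoning
        agree : ∀ i → Behind (toℕ s) i → σ i ≡ τ i
        agree i i∈S = sym (τ≡σ-off i
          (λ { refl → ¬Behind-ahead (subst (toℕ s ≤_) s+1≡t (n≤1+n _)) (subst (Behind (toℕ s)) (sym at≡u) i∈S) })
          (λ { refl → ¬Behind-ahead ≤-refl (subst (Behind (toℕ s)) (sym as≡w) i∈S) }))

      ¬leave-end : ∀ {t : Fin k} → toℕ t ≡ suc ℓ → ¬ InA w → (∀ s → a s ≢ w) → ¬ toℕ t < centresBehind σ (toℕ t)
      ¬leave-end {t} t≡end w∉A w∉path t<c = <-irrefl refl (begin-strict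
        suc (suc ℓ)              ≡⟨ cong suc t≡end ⟨
        suc (toℕ t)              ≤⟨ t<c ⟩
        centresBehind σ (toℕ t)  <⟨ count-mono-< (λ i → Behind? (toℕ t) i ×-dec σ i ≟ ctr) (λ i → σ i ≟ ctr)
                                                 (λ _ → proj₂) w σw≡ctr w∉Behind ⟩
        count (λ i → σ i ≟ ctr)  ≡⟨ centres ⟩
        suc (suc ℓ)              ∎)
        where
        open ≤-Reasoning
        w∉Behind : ¬ (Behind (toℕ t) w × σ w ≡ ctr)
        w∉Behind (inj₁ (w∈A , _) , _) = w∉A w∈A
        w∉Behind (inj₂ (r , _ , ar≡w) , _) = w∉path r ar≡w

      moved : ASided σ u → ASided τ w
      moved (inj₁ u∈A′) = from-A u∈A′
      moved (inj₂ (t , at≡u , t<c)) with pathNeighbour {t} {w} (subst (λ x → E X x w) (sym at≡u) e)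
      ... | on-path s as≡w (inj₁ s≡t+1) = inj₂ (s , as≡w , forward at≡u as≡w s≡t+1 t<c)
      ... | on-path s as≡w (inj₂ s+1≡t) = inj₂ (s , as≡w , backward at≡u as≡w s+1≡t t<c)
      ... | into-A refl w∈A = inj₁ (w∈A , λ w≡a0 → irrefl X (subst₂ (E X) (sym at≡u) w≡a0 e))
      ... | beyond t≡end w∉A w∉path = ⊥-elim (¬leave-end t≡end w∉A w∉path t<c)

      unmoved : ∀ {v} → v ≢ u → v ≢ w → ASided σ v → ASided τ v
      unmoved v≢u v≢w (inj₁ v∈A′) = inj₁ v∈A′
      unmoved v≢u v≢w (inj₂ (t , at≡v , t<c)) = inj₂ (t , at≡v , subst (toℕ t <_) (sym (centresBehind-swap σ e
        (λ u≡at → v≢u (trans (sym at≡v) (sym u≡at))) (λ w≡at → v≢w (trans (sym at≡v) (sym w≡at))))) t<c)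

      preserves : ∀ v → σ v ≢ ctr → ASided σ v → ASided τ (swap u w v)
      preserves v σv≢ctr v-sided = by-cases (v ≟ u) (v ≟ w)
        where
        by-cases : Dec (v ≡ u) → Dec (v ≡ w) → ASided τ (swap u w v)
        by-cases (yes refl) _ = subst (ASided τ) (sym (swap-left v w)) (moved v-sided)
        by-cases (no _) (yes refl) = ⊥-elim (σv≢ctr σw≡ctr)
        by-cases (no v≢u) (no v≢w) = subst (ASided τ) (sym (swap-other u w v v≢u v≢w)) (unmoved v≢u v≢w v-sided)

    move-reflects : ∀ σ → count (λ i → σ i ≟ ctr) ≡ k → ∀ {u w} → E X u w → σ w ≡ ctr → σ u ≢ ctr →
                    ∀ v → σ v ≢ ctr → ASided (σ ∘ swap u w) (swap u w v) → ASided σ v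
    move-reflects σ centres {u} {w} e σw≡ctr σu≢ctr v σv≢ctr τ-sided =
      ASided-cong undo (subst (ASided (τ ∘ swap w u)) back
        (Move.preserves τ (trans (count-swap (λ i → σ i ≟ ctr) u w) centres) (E-sym X e)
          (Move.τu≡ctr σ centres e σw≡ctr σu≢ctr) τw≢ctr (swap u w v) τv≢ctr τ-sided))
      where
      τ : Fin n → Fin m
      τ = σ ∘ swap u w
      τw≢ctr : τ w ≢ ctr
      τw≢ctr = σu≢ctr ∘ trans (sym (cong σ (swap-right u w)))
      τv≢ctr : τ (swap u w v) ≢ ctr
      τv≢ctr = σv≢ctr ∘ trans (sym (cong σ (swap-involutive u w v)))
      back : swap w u (swap u w v) ≡ v
      back = trans (swap-sym w u (swap u w v)) (swap-involutive u w v)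
      undo : ∀ i → τ (swap w u i) ≡ σ i
      undo i = cong σ (trans (cong (swap u w) (swap-sym w u i)) (swap-involutive u w i))

    Outside⇒¬ASided : ∀ {σ v} → Outside v → ¬ ASided σ v
    Outside⇒¬ASided (v∉A , _) (inj₁ (v∈A , _)) = v∉A v∈A
    Outside⇒¬ASided (_ , v∉path) (inj₂ (t , at≡v , _)) = v∉path (t , at≡v)

module Disconnection {n ℓ m : ℕ} (X : SimpleGraph n) (bridge : KBridge X (suc (suc ℓ)))
                     (InA? : Decidable (Star (KBridge.E' bridge) (KBridge.a bridge zero)))
                     (ctr : Fin m) (c : Fin m → ℕ) (c-ctr : c ctr ≡ suc (suc ℓ)) where

  open Bridge X bridge InA?
  open Tokens ctr

  Config : Set
  Config = FSVertex n m c

  _⟶_ : Config → Config → Set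
  _⟶_ = FSAdj X (StarAdj ctr) c

  centres : (s : Config) → count (λ i → proj₁ s i ≟ ctr) ≡ k
  centres s = trans (fibre-count s ctr) c-ctr

  leaf-moves : ∀ {s t} → s ⟶ t → ∀ v → proj₁ s v ≢ ctr →
               ∃ λ v′ → proj₁ t v′ ≡ proj₁ s v × (ASided (proj₁ s) v ⇔ ASided (proj₁ t) v′)
  leaf-moves {s@(σ , _)} {t} move v σv≢ctr with star-move {X = X} {ctr} {c} {s} {t} move
  ... | u , w , e , σw≡ctr , σu≢ctr , τ≗σ∘swap =
    swap u w v , trans (τ≗σ∘swap (swap u w v)) (cong σ (swap-involutive u w v)) ,
    mk⇔ (ASided-cong (sym ∘ τ≗σ∘swap) ∘ Move.preserves σ (centres s) e σw≡ctr σu≢ctr v σv≢ctr)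
        (move-reflects σ (centres s) e σw≡ctr σu≢ctr v σv≢ctr ∘ ASided-cong τ≗σ∘swap)

  ASidedLeaf NonASidedLeaf : Fin m → Config → Set
  ASidedLeaf y (σ , _) = ∃ λ v → σ v ≡ y × ASided σ v
  NonASidedLeaf y (σ , _) = ∃ λ v → σ v ≡ y × ¬ ASided σ v

  ASidedLeaf-step : ∀ {y} → y ≢ ctr → ∀ {s t} → s ⟶ t → ASidedLeaf y s → ASidedLeaf y t
  ASidedLeaf-step y≢ctr {s} {t} move (v , σv≡y , sided) =
    let v′ , τv′≡σv , sided⇔ = leaf-moves {s} {t} move v (y≢ctr ∘ trans (sym σv≡y))
    in v′ , trans τv′≡σv σv≡y , Equivalence.to sided⇔ sided

  NonASidedLeaf-step : ∀ {y} → y ≢ ctr → ∀ {s t} → s ⟶ t → NonASidedLeaf y s → NonASidedLeaf y t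
  NonASidedLeaf-step y≢ctr {s} {t} move (v , σv≡y , not-sided) =
    let v′ , τv′≡σv , sided⇔ = leaf-moves {s} {t} move v (y≢ctr ∘ trans (sym σv≡y))
    in v′ , trans τv′≡σv σv≡y , not-sided ∘ Equivalence.from sided⇔

  ASidedLeaf-along : ∀ {y} → y ≢ ctr → ∀ {s t} → Star _⟶_ s t → ASidedLeaf y s → ASidedLeaf y t
  ASidedLeaf-along y≢ctr = preserved-along (ASidedLeaf _) (λ {s} {t} → ASidedLeaf-step y≢ctr {s} {t})

  NonASidedLeaf-along : ∀ {y} → y ≢ ctr → ∀ {s t} → Star _⟶_ s t → NonASidedLeaf y s → NonASidedLeaf y t
  NonASidedLeaf-along y≢ctr = preserved-along (NonASidedLeaf _) (λ {s} {t} → NonASidedLeaf-step y≢ctr {s} {t})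

  fibres-bound : (s : Config) → ∀ {y z} → y ≢ ctr → z ≢ ctr → y ≢ z → c y + c z + k ≤ n
  fibres-bound s@(σ , _) {y} {z} y≢ctr z≢ctr y≢z = begin
    c y + c z + k
      ≡⟨ cong₂ _+_ (cong₂ _+_ (fibre-count s y) (fibre-count s z)) (centres s) ⟨
    count (σ≟ y) + count (σ≟ z) + count (σ≟ ctr)
      ≡⟨ cong (_+ count (σ≟ ctr)) (count-disjoint-∪ (σ≟ y) (σ≟ z) λ i σi≡y σi≡z → y≢z (trans (sym σi≡y) σi≡z)) ⟨
    count (λ i → σ≟ y i ⊎-dec σ≟ z i) + count (σ≟ ctr)
      ≡⟨ count-disjoint-∪ (λ i → σ≟ y i ⊎-dec σ≟ z i) (σ≟ ctr) leaves-not-centre ⟨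
    count (λ i → (σ≟ y i ⊎-dec σ≟ z i) ⊎-dec σ≟ ctr i)
      ≤⟨ count-≤ (λ i → (σ≟ y i ⊎-dec σ≟ z i) ⊎-dec σ≟ ctr i) ⟩
    n ∎
    where
    open ≤-Reasoning
    σ≟ : ∀ y → Decidable (λ i → σ i ≡ y)
    σ≟ y i = σ i ≟ y
    leaves-not-centre : ∀ i → σ i ≡ y ⊎ σ i ≡ z → σ i ≢ ctr
    leaves-not-centre i (inj₁ σi≡y) σi≡ctr = y≢ctr (trans (sym σi≡y) σi≡ctr)
    leaves-not-centre i (inj₂ σi≡z) σi≡ctr = z≢ctr (trans (sym σi≡z) σi≡ctr)

  leaf-fits : Config → ∀ {y z} → y ≢ ctr → z ≢ ctr → y ≢ z → c y ≤ count Outside? ⊎ c z ≤ count InA′?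
  leaf-fits s {y} {z} y≢ctr z≢ctr y≢z with c y ℕ.≤? count Outside?
  ... | yes y-fits = inj₁ y-fits
  ... | no y-overflows = inj₂ (+-cancelʳ-≤ (count Outside?) _ _ (begin
    c z + count Outside?          ≤⟨ +-monoʳ-≤ (c z) (<⇒≤ (≰⇒> y-overflows)) ⟩
    c z + c y                     ≡⟨ +-comm (c z) (c y) ⟩
    c y + c z                     ≤⟨ +-cancelʳ-≤ k _ _ (≤-trans (fibres-bound s y≢ctr z≢ctr y≢z) vertices-bound) ⟩
    count InA′? + count Outside?  ∎))
    where open ≤-Reasoning

  module _ (positive : ∀ y → 0 < c y) (connected : FSConnected X (StarAdj ctr) c) (s : Config)
           {y : Fin m} (y≢ctr : y ≢ ctr) where

    ¬fits-outside : ¬ c y ≤ count Outside?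
    ¬fits-outside y-fits =
      let wA , wA≢a0 , wA∈A = A-nontrivial
          ρ , ρwA≡y = place s y (positive y) wA
          τ , τ-outside = gather s y Outside? y-fits
          v , τv≡y , v-sided = ASidedLeaf-along y≢ctr (connected ρ τ) (wA , ρwA≡y , inj₁ (wA∈A , wA≢a0))
      in Outside⇒¬ASided (τ-outside v τv≡y) v-sided

    ¬fits-in-A : ¬ c y ≤ count InA′?
    ¬fits-in-A y-fits =
      let wB , _ = B-nontrivial
          ρ , ρwB≡y = place s y (positive y) wB
          τ , τ-inA′ = gather s y InA′? y-fits
          v , τv≡y , v-not-sided = NonASidedLeaf-along y≢ctr (connected ρ τ) (wB , ρwB≡y , Outside⇒¬ASided B-outside)
      in v-not-sided (inj₁ (τ-inA′ v τv≡y))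

  disconnected : (∀ y → 0 < c y) → totalMult c ≡ n → ∀ {y z} → y ≢ ctr → z ≢ ctr → y ≢ z →
                 ¬ FSConnected X (StarAdj ctr) c
  disconnected positive total y≢ctr z≢ctr y≢z connected =
    [ ¬fits-outside positive connected s y≢ctr , ¬fits-in-A positive connected s z≢ctr ] (leaf-fits s y≢ctr z≢ctr y≢z)
    where
    s : Config
    s = configuration c total

¬¬-decidable : ∀ {n} (P : Pred (Fin n) 0ℓ) → ¬ ¬ Decidable P
¬¬-decidable {zero} P ¬dec = ¬dec λ ()
¬¬-decidable {suc n} P ¬dec = ¬¬-excluded-middle λ P0? →
  ¬¬-decidable (P ∘ suc) λ Psuc? → ¬dec λ { zero → P0? ; (suc i) → Psuc? i }

two-leaves : ∀ {m} → 2 < m → (ctr : Fin m) → ∃ λ y → ∃ λ z → y ≢ ctr × z ≢ ctr × y ≢ z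
two-leaves (s≤s (s≤s (s≤s _))) zero = suc zero , suc (suc zero) , (λ ()) , (λ ()) , (λ ())
two-leaves (s≤s (s≤s (s≤s _))) (suc zero) = zero , suc (suc zero) , (λ ()) , (λ ()) , (λ ())
two-leaves (s≤s (s≤s (s≤s _))) (suc (suc _)) = zero , suc zero , (λ ()) , (λ ()) , (λ ())

proposition4p1 : ∀ {n m k : ℕ} (X : SimpleGraph n) → Connected X → HasKBridge X k →
                 2 < m → 2 ≤ k → (ctr : Fin m) (c : Fin m → ℕ) →
                 (∀ y → 0 < c y) → c ctr ≡ k → totalMult c ≡ n →
                 ¬ FSConnected X (StarAdj ctr) c
proposition4p1 X _ bridge 2<m (s≤s (s≤s z≤n)) ctr c positive c-ctr total connected =
  let y , z , y≢ctr , z≢ctr , y≢z = two-leaves 2<m ctr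
  -- Membership in A need not be decidable constructively, but the goal is a negation.
  in ¬¬-decidable (Star (KBridge.E' bridge) (KBridge.a bridge zero)) λ InA? →
       Disconnection.disconnected X bridge InA? ctr c c-ctr positive total y≢ctr z≢ctr y≢z connected
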